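{- Let $\{\mathcal{C}_k\}_{k>0}$ be a resource-indexed arboreal category and consider a resource-indexed arboreal adjunction $L_k\dashv R_k\colon \mathcal{E}\to\mathcal{C}_k$ ($k>0$) which has the bisimilar companion property. Then property (HP) holds: for every $k>0$ and every full subcategory $\mathcal{D}$ of $\mathcal{E}$ that is saturated under $\leftrightarrow_k$, $\mathcal{D}$ is closed under morphisms if and only if $\mathcal{D}$ is upwards closed with respect to $\to_k$.
   Context: All categories are locally small and well-powered. A proper factorisation system $(\mathcal{Q},\mathcal{M})$ on a category $\mathcal{C}$ consists of two classes of morphisms such that every morphism factors as $m\circ e$ with $e\in\mathcal{Q}$, $m\in\mathcal{M}$; $\mathcal{Q}$ is exactly the class of morphisms having the left lifting property with respect to all of $\mathcal{M}$ and $\mathcal{M}$ is exactly the class having the right lifting property with respect to all of $\mathcal{Q}$; every morphism in $\mathcal{Q}$ is epic and every morphism in $\mathcal{M}$ is monic. $\mathcal{M}$-morphisms are called embeddings, $\mathcal{Q}$-morphisms quotients. For an object $X$, $\mathrm{S}X$ denotes the poset of embeddings with codomain $X$ modulo isomorphism over $X$, with $m\le n$ iff $m=n\circ i$ for some $i$. An object $P$ is a path if $\mathrm{S}P$ is a finite chain; a path embedding is an embedding whose domain is a path, and $\mathrm{P}X\subseteq \mathrm{S}X$ is the subposet of path embeddings. $X$ is path-generated if the cocone of all path embeddings into $X$ is a colimit cocone. The factorisation system is stable if the pullback of any quotient along any embedding exists and is a quotient. An arboreal category is a category with a stable proper factorisation system such that: coproducts of sets of paths exist; for paths $P,Q,Q'$,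 if a composite $P\to Q\to Q'$ is a quotient then so is $P\to Q$; every object is path-generated; every path $P$ is connected (for every nonempty set of paths $\{P_i\}$, every morphism $P\to\coprod_i P_i$ factors through some coproduct injection). In an arboreal category each $\mathrm{P}X$ is a tree. A morphism $f\colon X\to Y$ is open if for every commutative square formed by path embeddings $P\to Q$, $P\to X$, $Q\to Y$ (with $f$ the bottom side) there is $Q\to X$ making both triangles commute; it is a pathwise embedding if $f\circ m$ is a path embedding for every path embedding $m$ into $X$. Objects $X,Y$ are bisimilar if there is a span $X\leftarrow Z\to Y$ of open pathwise embeddings. A resource-indexed arboreal category is an arboreal category $\mathcal{C}$ with full subcategories $\mathcal{C}_p^1\subseteq\mathcal{C}_p^2\subseteq\cdots$ of the full subcategory of paths, each closed under embeddings between paths and containing the initial object; $\mathcal{C}_k$ is the full subcategory of objects whose cocone of path embeddings with domain in $\mathcal{C}_p^k$ is a colimit cocone in $\mathcal{C}$ (each $\mathcal{C}_k$ is arboreal with paths exactly $\mathcal{C}_p^k$). A resource-indexed arboreal adjunction between a category $\mathcal{E}$ and $\mathcal{C}$ is a family of adjunctions $L_k\dashv R_k$ with $L_k\colon\mathcal{C}_k\to\mathcal{E}$, $R_k\colon\mathcal{E}\to\mathcal{C}_k$; write $G_k=L_kR_k$. For $a,b\in\mathcal{E}$: $a\to_k b$ iff there is a morphism $R_ka\to R_kb$ in $\mathcal{C}_k$; $a\leftrightarrow_k b$ iff $R_ka$ and $R_kb$ are bisimilar in $\mathcal{C}_k$. The adjunction has the bisimilar companion property if $a\leftrightarrow_k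 G_ka$ for all $a\in\mathcal{E}$ and $k>0$. A full subcategory $\mathcal{D}$ of $\mathcal{E}$ is closed under morphisms if $a\in\mathcal{D}$ and a morphism $a\to b$ imply $b\in\mathcal{D}$; it is saturated under (resp. upwards closed with respect to) a relation $\nabla$ if $a\in\mathcal{D}$ and $a\nabla b$ imply $b\in\mathcal{D}$. -}

module Defs where

open import Level using (Level; _⊔_) renaming (suc to lsuc)
open import Data.Nat using (ℕ) renaming (suc to nsuc)
open import Data.Fin using (Fin)
open import Data.Product using (Σ; Σ-syntax; _×_; _,_; proj₁; proj₂)
open import Data.Sum using (_⊎_)
open import Relation.Binary using (IsEquivalence)

record Category (o ℓ e : Level) : Set (lsuc (o ⊔ ℓ ⊔ e)) where
  infixr 9 _∘_
  infix 4 _≈_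
  infix 4 _⇒_
  field
    Obj : Set o
    _⇒_ : Obj → Obj → Set ℓ
    _≈_ : ∀ {A B} → A ⇒ B → A ⇒ B → Set e
    id : ∀ {A} → A ⇒ A
    _∘_ : ∀ {A B C} → B ⇒ C → A ⇒ B → A ⇒ C
    ≈-equiv : ∀ {A B} → IsEquivalence (_≈_ {A} {B})
    ∘-resp-≈ : ∀ {A B C} {f g : B ⇒ C} {h i : A ⇒ B} → f ≈ g → h ≈ i → f ∘ h ≈ g ∘ i
    identityˡ : ∀ {A B} {f : A ⇒ B} → id ∘ f ≈ f
    identityʳ : ∀ {A B} {f : A ⇒ B} → f ∘ id ≈ f
    assoc : ∀ {A B C D} {f : A ⇒ B} {g : B ⇒ C} {h : C ⇒ D} → (h ∘ g) ∘ f ≈ h ∘ (g ∘ f)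

FullSub : ∀ {o ℓ e p} (C : Category o ℓ e) → (Category.Obj C → Set p) → Category (o ⊔ p) ℓ e
FullSub C P = record
  { Obj = Σ[ X ∈ Obj ] P X
  ; _⇒_ = λ X Y → proj₁ X ⇒ proj₁ Y
  ; _≈_ = _≈_
  ; id = id
  ; _∘_ = _∘_
  ; ≈-equiv = ≈-equiv
  ; ∘-resp-≈ = ∘-resp-≈
  ; identityˡ = identityˡ
  ; identityʳ = identityʳ
  ; assoc = assoc
  }
  where open Category C

record Functor {o ℓ e o' ℓ' e'} (C : Category o ℓ e) (D : Category o' ℓ' e')
       : Set (o ⊔ ℓ ⊔ e ⊔ o' ⊔ ℓ' ⊔ e') where
  private
    module C = Category C
    module D = Category D
  field
    F₀ : C.Obj → D.Obj
    F₁ : ∀ {A B} → A C.⇒ B → F₀ A D.⇒ F₀ B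
    identity : ∀ {A} → F₁ (C.id {A}) D.≈ D.id
    homomorphism : ∀ {A B X} {f : A C.⇒ B} {g : B C.⇒ X} → F₁ (g C.∘ f) D.≈ F₁ g D.∘ F₁ f
    F-resp-≈ : ∀ {A B} {f g : A C.⇒ B} → f C.≈ g → F₁ f D.≈ F₁ g

record Adjunction {o ℓ e o' ℓ' e'} {C : Category o ℓ e} {D : Category o' ℓ' e'}
       (L : Functor C D) (R : Functor D C) : Set (o ⊔ ℓ ⊔ e ⊔ o' ⊔ ℓ' ⊔ e') where
  private
    module C = Category C
    module D = Category D
    module L = Functor L
    module R = Functor R
  field
    unit : ∀ X → X C.⇒ R.F₀ (L.F₀ X)
    counit : ∀ A → L.F₀ (R.F₀ A) D.⇒ A
    unit-natural : ∀ {X Y} (f : X C.⇒ Y) → unit Y C.∘ f C.≈ R.F₁ (L.F₁ f) C.∘ unit X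
    counit-natural : ∀ {A B} (g : A D.⇒ B) → counit B D.∘ L.F₁ (R.F₁ g) D.≈ g D.∘ counit A
    zig : ∀ X → counit (L.F₀ X) D.∘ L.F₁ (unit X) D.≈ D.id
    zag : ∀ A → R.F₁ (counit A) C.∘ unit (R.F₀ A) C.≈ C.id

module CatDefs {o ℓ e} (C : Category o ℓ e) where
  open Category C

  MorClass : ∀ q → Set (o ⊔ ℓ ⊔ lsuc q)
  MorClass q = ∀ {A B} → A ⇒ B → Set q

  Epi : ∀ {A B} → A ⇒ B → Set (o ⊔ ℓ ⊔ e)
  Epi {A} {B} f = ∀ {Z} (g h : B ⇒ Z) → g ∘ f ≈ h ∘ f → g ≈ h

  Mono : ∀ {A B} → A ⇒ B → Set (o ⊔ ℓ ⊔ e)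
  Mono {A} {B} f = ∀ {Z} (g h : Z ⇒ A) → f ∘ g ≈ f ∘ h → g ≈ h

  LLP : ∀ {A B X Y} → A ⇒ B → X ⇒ Y → Set (ℓ ⊔ e)
  LLP {A} {B} {X} {Y} f g =
    (u : A ⇒ X) (v : B ⇒ Y) → g ∘ u ≈ v ∘ f →
    Σ[ d ∈ B ⇒ X ] (d ∘ f ≈ u × g ∘ d ≈ v)

  IsInitial : Obj → Set (o ⊔ ℓ ⊔ e)
  IsInitial I = ∀ Y → Σ[ h ∈ I ⇒ Y ] (∀ (h' : I ⇒ Y) → h' ≈ h)

  record Pullback {A B X} (f : A ⇒ B) (g : X ⇒ B) : Set (o ⊔ ℓ ⊔ e) where
    field
      P : Obj
      p₁ : P ⇒ A
      p₂ : P ⇒ X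
      commute : f ∘ p₁ ≈ g ∘ p₂
      universal : ∀ {Z} (x : Z ⇒ A) (y : Z ⇒ X) → f ∘ x ≈ g ∘ y →
        Σ[ u ∈ Z ⇒ P ] ((p₁ ∘ u ≈ x × p₂ ∘ u ≈ y) ×
          (∀ (u' : Z ⇒ P) → p₁ ∘ u' ≈ x → p₂ ∘ u' ≈ y → u' ≈ u))

  record Coproduct {i} {I : Set i} (X : I → Obj) : Set (o ⊔ ℓ ⊔ e ⊔ i) where
    field
      obj : Obj
      inj : ∀ j → X j ⇒ obj
      universal : ∀ {Y} (f : ∀ j → X j ⇒ Y) →
        Σ[ h ∈ obj ⇒ Y ] ((∀ j → h ∘ inj j ≈ f j) ×
          (∀ (h' : obj ⇒ Y) → (∀ j → h' ∘ inj j ≈ f j) → h' ≈ h))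

  record ProperFactorisationSystem (q : Level) : Set (o ⊔ ℓ ⊔ e ⊔ lsuc q) where
    field
      𝒬 : MorClass q
      ℳ : MorClass q
      factor : ∀ {A B} (f : A ⇒ B) →
        Σ[ Z ∈ Obj ] Σ[ q ∈ A ⇒ Z ] Σ[ m ∈ Z ⇒ B ] (𝒬 q × ℳ m × m ∘ q ≈ f)
      𝒬⇒LLP : ∀ {A B} (f : A ⇒ B) → 𝒬 f → ∀ {X Y} (g : X ⇒ Y) → ℳ g → LLP f g
      LLP⇒𝒬 : ∀ {A B} (f : A ⇒ B) → (∀ {X Y} (g : X ⇒ Y) → ℳ g → LLP f g) → 𝒬 f
      ℳ⇒RLP : ∀ {X Y} (g : X ⇒ Y) → ℳ g → ∀ {A B} (f : A ⇒ B) → 𝒬 f → LLP f g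
      RLP⇒ℳ : ∀ {X Y} (g : X ⇒ Y) → (∀ {A B} (f : A ⇒ B) → 𝒬 f → LLP f g) → ℳ g
      𝒬-epi : ∀ {A B} (f : A ⇒ B) → 𝒬 f → Epi f
      ℳ-mono : ∀ {A B} (f : A ⇒ B) → ℳ f → Mono f

  module FSDefs {q} (F : ProperFactorisationSystem q) where
    open ProperFactorisationSystem F

    -- embeddings with codomain X (representatives of elements of S X)
    Sub : Obj → Set (o ⊔ ℓ ⊔ q)
    Sub X = Σ[ A ∈ Obj ] Σ[ m ∈ A ⇒ X ] ℳ m

    _≤S_ : ∀ {X} → Sub X → Sub X → Set (ℓ ⊔ e)
    (A , m , _) ≤S (B , n , _) = Σ[ i ∈ A ⇒ B ] (m ≈ n ∘ i)

    _≃S_ : ∀ {X} → Sub X → Sub X → Set (ℓ ⊔ e)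
    s ≃S t = s ≤S t × t ≤S s

    -- S X (= Sub X modulo ≃S) is a finite chain: it is total, and finitely
    -- many embeddings represent all of its elements.
    SIsFiniteChain : Obj → Set (o ⊔ ℓ ⊔ e ⊔ q)
    SIsFiniteChain X =
      (∀ (s t : Sub X) → s ≤S t ⊎ t ≤S s) ×
      Σ[ n ∈ ℕ ] Σ[ f ∈ (Fin n → Sub X) ] (∀ (s : Sub X) → Σ[ j ∈ Fin n ] (s ≃S f j))

    IsPath : Obj → Set (o ⊔ ℓ ⊔ e ⊔ q)
    IsPath P = SIsFiniteChain P

    -- The cocone of all embeddings P ↣ X whose domain satisfies K
    -- (K: paths, or paths of a given resource level) is a colimit cocone.
    IsEmbColimit : ∀ {p} → (Obj → Set p) → Obj → Set (o ⊔ ℓ ⊔ e ⊔ q ⊔ p)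
    IsEmbColimit K X =
      ∀ Y (c : ∀ {P} (m : P ⇒ X) → ℳ m → K P → P ⇒ Y) →
      (∀ {P P'} (m : P ⇒ X) (mm : ℳ m) (kP : K P) (n : P' ⇒ X) (mn : ℳ n) (kP' : K P')
         (i : P ⇒ P') → n ∘ i ≈ m → c n mn kP' ∘ i ≈ c m mm kP) →
      Σ[ h ∈ X ⇒ Y ]
        ((∀ {P} (m : P ⇒ X) (mm : ℳ m) (kP : K P) → h ∘ m ≈ c m mm kP) ×
         (∀ (h' : X ⇒ Y) → (∀ {P} (m : P ⇒ X) (mm : ℳ m) (kP : K P) → h' ∘ m ≈ c m mm kP) →
            h' ≈ h))

    IsPathGenerated : Obj → Set (o ⊔ ℓ ⊔ e ⊔ q)
    IsPathGenerated X = IsEmbColimit IsPath X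

    Stable : Set (o ⊔ ℓ ⊔ e ⊔ q)
    Stable = ∀ {A B X} (f : A ⇒ B) (m : X ⇒ B) → 𝒬 f → ℳ m →
      Σ[ pb ∈ Pullback f m ] 𝒬 (Pullback.p₂ pb)

    -- Open maps, pathwise embeddings and bisimilarity, relative to a class
    -- Pth of path objects and a class Ob of admissible objects (of a full
    -- subcategory whose embeddings are those of C between its objects).
    IsOpen : ∀ {p} → (Obj → Set p) → ∀ {X Y} → X ⇒ Y → Set (o ⊔ ℓ ⊔ e ⊔ q ⊔ p)
    IsOpen Pth {X} {Y} f =
      ∀ {P Q} (j : P ⇒ Q) → ℳ j → Pth P → Pth Q →
      (m : P ⇒ X) → ℳ m → (n : Q ⇒ Y) → ℳ n → f ∘ m ≈ n ∘ j →
      Σ[ d ∈ Q ⇒ X ] (d ∘ j ≈ m × f ∘ d ≈ n)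

    IsPathwiseEmb : ∀ {p} → (Obj → Set p) → ∀ {X Y} → X ⇒ Y → Set (o ⊔ ℓ ⊔ q ⊔ p)
    IsPathwiseEmb Pth {X} {Y} f = ∀ {P} (m : P ⇒ X) → ℳ m → Pth P → ℳ (f ∘ m)

    Bisimilar : ∀ {p r} → (Obj → Set p) → (Obj → Set r) → Obj → Obj → Set (o ⊔ ℓ ⊔ e ⊔ q ⊔ p ⊔ r)
    Bisimilar Pth Ob X Y =
      Σ[ Z ∈ Obj ] (Ob Z × Σ[ f ∈ Z ⇒ X ] Σ[ g ∈ Z ⇒ Y ]
        ((IsOpen Pth f × IsPathwiseEmb Pth f) × (IsOpen Pth g × IsPathwiseEmb Pth g)))

  record Arboreal (q i : Level) : Set (o ⊔ ℓ ⊔ e ⊔ lsuc q ⊔ lsuc i) where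
    field
      fs : ProperFactorisationSystem q
    open ProperFactorisationSystem fs
    open FSDefs fs
    field
      stable : Stable
      coproducts : (I : Set i) (Ps : I → Obj) → (∀ j → IsPath (Ps j)) → Coproduct Ps
      quotient-cancel : ∀ {P Q Q'} (f : P ⇒ Q) (g : Q ⇒ Q') →
        IsPath P → IsPath Q → IsPath Q' → 𝒬 (g ∘ f) → 𝒬 f
      path-generated : ∀ X → IsPathGenerated X
      connected : ∀ {P} → IsPath P → (I : Set i) → I → (Ps : I → Obj)
        (pp : ∀ j → IsPath (Ps j)) (f : P ⇒ Coproduct.obj (coproducts I Ps pp)) →
        Σ[ j ∈ I ] Σ[ g ∈ P ⇒ Ps j ] (Coproduct.inj (coproducts I Ps pp) j ∘ g ≈ f)

  -- Resource indexing.  Index k : ℕ stands for the paper's resource k+1,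
  -- so that k ranges over all positive resources.
  record ResourceIndexed {q i} (A : Arboreal q i) (p : Level)
         : Set (o ⊔ ℓ ⊔ e ⊔ q ⊔ lsuc p) where
    open Arboreal A
    open ProperFactorisationSystem fs
    open FSDefs fs
    field
      Cp : ℕ → Obj → Set p
      Cp-path : ∀ k {P} → Cp k P → IsPath P
      Cp-incl : ∀ k {P} → Cp k P → Cp (nsuc k) P
      Cp-emb : ∀ k {P Q} (m : Q ⇒ P) → ℳ m → IsPath Q → Cp k P → Cp k Q
      Cp-initial : ∀ k {I} → IsInitial I → Cp k I

    Ck : ℕ → Obj → Set (o ⊔ ℓ ⊔ e ⊔ q ⊔ p)
    Ck k X = IsEmbColimit (Cp k) X

    Cat : ℕ → Category (o ⊔ ℓ ⊔ e ⊔ q ⊔ p) ℓ e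
    Cat k = FullSub C (Ck k)

record RIAdjunction {o ℓ e q i p o' ℓ' e'} {C : Category o ℓ e}
       {A : CatDefs.Arboreal C q i} (RI : CatDefs.ResourceIndexed C A p)
       (E : Category o' ℓ' e') : Set (o ⊔ ℓ ⊔ e ⊔ q ⊔ p ⊔ o' ⊔ ℓ' ⊔ e') where
  open CatDefs.ResourceIndexed RI using (Cat)
  field
    L : (k : ℕ) → Functor (Cat k) E
    R : (k : ℕ) → Functor E (Cat k)
    adj : (k : ℕ) → Adjunction (L k) (R k)

module RIAdjDefs {o ℓ e q i p o' ℓ' e'} {C : Category o ℓ e}
       {A : CatDefs.Arboreal C q i} {RI : CatDefs.ResourceIndexed C A p}
       {E : Category o' ℓ' e'} (Adj : RIAdjunction RI E) where
  open RIAdjunction Adj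
  open CatDefs.Arboreal A using (fs)
  open CatDefs.ResourceIndexed RI using (Cp; Ck; Cat)
  open CatDefs.FSDefs C fs using (Bisimilar)
  private module E = Category E

  G : ℕ → E.Obj → E.Obj
  G k a = Functor.F₀ (L k) (Functor.F₀ (R k) a)

  _→[_]_ : E.Obj → ℕ → E.Obj → Set ℓ
  a →[ k ] b = Category._⇒_ (Cat k) (Functor.F₀ (R k) a) (Functor.F₀ (R k) b)

  _↔[_]_ : E.Obj → ℕ → E.Obj → Set (o ⊔ ℓ ⊔ e ⊔ q ⊔ p)
  a ↔[ k ] b = Bisimilar (Cp k) (Ck k) (proj₁ (Functor.F₀ (R k) a)) (proj₁ (Functor.F₀ (R k) b))

  BisimilarCompanion : Set (o ⊔ ℓ ⊔ e ⊔ q ⊔ p ⊔ o')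
  BisimilarCompanion = ∀ k a → a ↔[ k ] G k a

  ClosedUnderMorphisms : ∀ {d} → (E.Obj → Set d) → Set (o' ⊔ ℓ' ⊔ d)
  ClosedUnderMorphisms D = ∀ {a b} → D a → a E.⇒ b → D b

  SaturatedUnder : ∀ {d r} → (E.Obj → Set d) → (E.Obj → E.Obj → Set r) → Set (o' ⊔ d ⊔ r)
  SaturatedUnder D _∇_ = ∀ {a b} → D a → a ∇ b → D b

{-# OPTIONS --safe #-}
module Submission where

open import Defs
open import Data.Nat using (ℕ)
open import Data.Product using (_×_; _,_)

-- A morphism R_k a → R_k b transposes under L_k ⊣ R_k to G_k a → G_k b, and the
-- counit G_k b → b finishes the job; the bisimilar companion property is what
-- places G_k a in a ↔_k-saturated class alongside a.

module _ {o ℓ e q i p o' ℓ' e'} {C : Category o ℓ e} {A : CatDefs.Arboreal C q i}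
         {RI : CatDefs.ResourceIndexed C A p} {E : Category o' ℓ' e'}
         (Adj : RIAdjunction RI E) where

  open RIAdjunction Adj
  open RIAdjDefs Adj
  open Category E using (_⇒_)

  →ₖ⇒G-morphism : ∀ {k a b} → a →[ k ] b → G k a ⇒ G k b
  →ₖ⇒G-morphism {k} f = Functor.F₁ (L k) f

  ⇒-→ₖ : ∀ {k a b} → a ⇒ b → a →[ k ] b
  ⇒-→ₖ {k} g = Functor.F₁ (R k) g

  G-counit : ∀ k a → G k a ⇒ a
  G-counit k = Adjunction.counit (adj k)

  closed-G-stable⇒saturated-→ₖ : ∀ {d} {D : Category.Obj E → Set d} k →
    ClosedUnderMorphisms D → (∀ {a} → D a → D (G k a)) →
    SaturatedUnder D (λ a b → a →[ k ] b)
  closed-G-stable⇒saturated-→ₖ k closed D⇒DG {b = b} Da f =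
    closed (closed (D⇒DG Da) (→ₖ⇒G-morphism f)) (G-counit k b)

  saturated-→ₖ⇒closed : ∀ {d} {D : Category.Obj E → Set d} k →
    SaturatedUnder D (λ a b → a →[ k ] b) → ClosedUnderMorphisms D
  saturated-→ₖ⇒closed k upward Da g = upward Da (⇒-→ₖ {k} g)

  companion-saturated⇒G-stable : ∀ {d} {D : Category.Obj E → Set d} k →
    BisimilarCompanion → SaturatedUnder D (λ a b → a ↔[ k ] b) →
    ∀ {a} → D a → D (G k a)
  companion-saturated⇒G-stable k companion saturated {a} Da =
    saturated Da (companion k a)

proposition4p5 : ∀ {o ℓ e q i p o' ℓ' e' d}
    {C : Category o ℓ e} {A : CatDefs.Arboreal C q i}
    {RI : CatDefs.ResourceIndexed C A p} {E : Category o' ℓ' e'}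
    (Adj : RIAdjunction RI E) →
    RIAdjDefs.BisimilarCompanion Adj →
    (k : ℕ) (D : Category.Obj E → Set d) →
    RIAdjDefs.SaturatedUnder Adj D (λ a b → RIAdjDefs._↔[_]_ Adj a k b) →
    ((RIAdjDefs.ClosedUnderMorphisms Adj D → RIAdjDefs.SaturatedUnder Adj D (λ a b → RIAdjDefs._→[_]_ Adj a k b))
    × (RIAdjDefs.SaturatedUnder Adj D (λ a b → RIAdjDefs._→[_]_ Adj a k b) → RIAdjDefs.ClosedUnderMorphisms Adj D))
proposition4p5 Adj companion k D saturated =
    (λ closed → closed-G-stable⇒saturated-→ₖ Adj k closed
                  (companion-saturated⇒G-stable Adj k companion saturated))
  , saturated-→ₖ⇒closed Adj k
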